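{- Let $m\in\mathbb{Z}_2$ and $k\in\mathbb{Z}_2^\times$ with $k\ne1$, put $\ell=\frac{k-1}{2}$, and assume $v_2(\ell)\ge1$. If $v_2(m)>v_2(\ell)$, then: (1) $\gamma^m z_k$ is conjugate in $\Omega$ to $z_k$; (2) for all $n\ge v_2(\ell)$, the number of vertices at level $n$ not lying in a stable cycle of $\gamma^m z_k$ equals $2^{v_2(\ell)}$, i.e. $s_n(\gamma^m z_k)=2^n-2^{v_2(\ell)}$.
   Context: $T$ is the rooted binary tree of finite words over $X=\{0,1\}$, $\Omega=\mathrm{Aut}(T)$ acting on the right. Each $\alpha\in\Omega$ is uniquely $(\alpha_0,\alpha_1)\tau$, $\tau\in\{\mathrm{id},\sigma\}$, meaning $(xv)\alpha=(x)\tau\,(v)\alpha_x$. $\alpha^m$ for $m\in\mathbb{Z}_2$ is the $2$-adic limit of integer powers. Standard odometer $\gamma=(\gamma,\mathrm{id})\sigma$; for $k\in\mathbb{Z}_2^\times$ with $\ell=(k-1)/2$, $z_k=(z_k,\gamma^\ell z_k)$ recursively. $v_2$ is the $2$-adic valuation. A vertex $v$ at level $n$ lies in a stable cycle of $\alpha$ of length $k'$ if its $\alpha$-orbit has $k'$ elements and for every $m'>n$ the vertices at level $m'$ above this orbit form one $\alpha$-cycle of length $2^{m'-n}k'$; $s_n(\alpha)$ counts such vertices at level $n$. -}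

module Defs where

open import Data.Bool using (Bool; true; false; _xor_; if_then_else_)
open import Data.Nat using (ℕ; zero; suc; _+_; _*_; _^_; _≤_; _<_)
open import Data.List using (List; []; _∷_; length; _++_)
open import Data.List.Relation.Unary.All using (All)
open import Data.List.Relation.Unary.Unique.Propositional using (Unique)
open import Data.List.Membership.Propositional using (_∈_)
open import Data.Product using (Σ; _×_)
open import Relation.Nullary using (¬_)
open import Relation.Binary.PropositionalEquality using (_≡_; _≢_)

-- Vertices of the binary tree T: finite words over X = {0,1} = {false,true}.
Word : Set
Word = List Bool

-- An automorphism α ∈ Ω = Aut(T) is represented by its portrait:
-- the value at vertex w is the root permutation τ of the section α_w
-- (true = σ, false = id).  This is a bijective encoding of Aut(T).
Aut : Set
Aut = Word → Bool

act : Aut → Word → Word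
act p []      = []
act p (x ∷ v) = (x xor p []) ∷ act (λ w → p (x ∷ w)) v

-- product αβ (first α, then β):  αβ = (α_x β_{(x)τ_α})_x τ_α τ_β
comp : Aut → Aut → Aut
comp p q []      = p [] xor q []
comp p q (x ∷ w) = comp (λ u → p (x ∷ u)) (λ u → q ((x xor p []) ∷ u)) w

inv : Aut → Aut
inv p []      = p []
inv p (x ∷ w) = inv (λ u → p ((x xor p []) ∷ u)) w

idA : Aut
idA _ = false

natPow : Aut → ℕ → Aut
natPow p zero    = idA
natPow p (suc N) = comp (natPow p N) p

-- 2-adic integers as digit sequences: m = Σ_i m(i) 2^i
ℤ₂ : Set
ℤ₂ = ℕ → Bool

one₂ : ℤ₂
one₂ zero    = true
one₂ (suc _) = false

trunc : ℤ₂ → ℕ → ℕ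
trunc m zero    = 0
trunc m (suc n) = trunc m n + (if m n then 2 ^ n else 0)

-- α^m for m ∈ ℤ₂ (2-adic limit of integer powers): the portrait of α^m
-- at a vertex of length n is that of α^(m mod 2^(n+1)) (α acts on level
-- n+1 with order dividing 2^(n+1)).
pow : Aut → ℤ₂ → Aut
pow p m w = natPow p (trunc m (suc (length w))) w

-- (k-1)/2 for odd k: shift the digits
half : ℤ₂ → ℤ₂
half k i = k (suc i)

gamma : Aut
gamma []          = true
gamma (false ∷ w) = gamma w
gamma (true ∷ w)  = false

-- z_k = (z_k, γ^ℓ z_k), ℓ = (k-1)/2; defined with fuel ≥ word length
zAt : ℤ₂ → ℕ → Aut
zAt l zero    w           = false
zAt l (suc n) []          = false
zAt l (suc n) (false ∷ w) = zAt l n w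
zAt l (suc n) (true ∷ w)  = comp (pow gamma l) (zAt l n) w

z : ℤ₂ → Aut
z k w = zAt (half k) (length w) w

-- conjugacy in Ω (equality of automorphisms = equal action on all vertices)
Conjugate : Aut → Aut → Set
Conjugate p q = Σ Aut λ b → ∀ w → act (comp (comp (inv b) p) b) w ≡ act q w

HasVal : ℤ₂ → ℕ → Set
HasVal l a = (∀ i → i < a → l i ≡ false) × (l a ≡ true)

iter : {A : Set} → (A → A) → ℕ → A → A
iter f zero    x = x
iter f (suc n) x = f (iter f n x)

OrbitLen : Aut → Word → ℕ → Set
OrbitLen p w t = (0 < t) × (iter (act p) t w ≡ w)
               × (∀ s → 0 < s → s < t → iter (act p) s w ≢ w)

-- v (at level n = length v) lies in a stable cycle of α: its orbit has k'
-- elements and for every level n + j (j ≥ 1) the vertices above the orbit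
-- form one cycle of length 2^j k', i.e. every such vertex has orbit length 2^j k'
Stable : Aut → Word → Set
Stable p v = Σ ℕ λ k' → OrbitLen p v k'
           × (∀ u → 1 ≤ length u → OrbitLen p (v ++ u) (2 ^ length u * k'))

NonStableCount : Aut → ℕ → ℕ → Set
NonStableCount p n c = Σ (List Word) λ L → Unique L × All (λ v → length v ≡ n) L
  × (length L ≡ c)
  × (∀ v → length v ≡ n → (v ∈ L → ¬ Stable p v) × (¬ Stable p v → v ∈ L))

-- Read a vertex w of level n as the residue ⟦ w ⟧ modulo 2ⁿ of the binary number it spells,
-- first letter least significant. Then γ^c acts as x ↦ x − c and z_k as x ↦ x / k, so γ^m z_k
-- is x ↦ (x − m) / k. Writing k = 1 + 2^(a+1) ℓ′ and m = 2^(a+1) m′ with ℓ′ odd, the element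
-- γ^m′ z_ℓ′ : x ↦ (x − m′) / ℓ′ intertwines z_k with γ^m z_k, so the two are conjugate and
-- it maps the vertices of z_k outside stable cycles onto those of γ^m z_k.
-- For z_k, lifting the exponent (this is where a ≥ 1 is needed) shows that k^(2^e) − 1 has
-- 2-adic valuation exactly a + 1 + e. Hence a vertex 2^r (1 + 2t) of level r + 1 + a + E has an
-- orbit of length 2^E, which doubles at every level above; each of the 2^a vertices 2^(n−a) u
-- of level n is instead fixed together with its child, so it lies in no stable cycle.

module Submission where

open import Defs
open import Agda.Builtin.FromNat using (Number; fromNat)
open import Data.Bool using (Bool; true; false; _xor_)
open import Data.Bool.Properties using (xor-assoc)
open import Data.Empty using (⊥-elim)
open import Data.List using (List; []; _∷_; length; _++_; replicate; [_]; map)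
open import Data.List.Membership.Propositional using (_∈_)
open import Data.List.Membership.Propositional.Properties using (∈-map⁺; ∈-map⁻; ∈-++⁺ˡ; ∈-++⁺ʳ)
import Data.List.Relation.Unary.AllPairs as AllPairs
open import Data.List.Relation.Unary.Any using (here)
open import Data.List.Relation.Unary.Unique.Propositional using (Unique)
import Data.List.Relation.Unary.All as All
import Data.List.Relation.Unary.All.Properties as All
import Data.List.Relation.Unary.Unique.Propositional.Properties as Unique
import Data.List.Properties as List
open import Data.Nat using (ℕ; zero; suc; z≤n; s≤s)
import Data.Nat as ℕ
import Data.Nat.Literals as ℕ
import Data.Nat.Properties as ℕ
import Data.Nat.DivMod as ℕ
import Data.Nat.Divisibility as ℕ
import Data.Nat.Tactic.RingSolver as ℕ
open import Data.Product using (∃; _×_; _,_; proj₁; proj₂)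
open import Data.Sum using (_⊎_; inj₁; inj₂)
open import Data.Unit using (tt)
open import Function using (_∘_; case_of_)
open import Relation.Nullary using (¬_; contradiction)
open import Relation.Binary.PropositionalEquality hiding ([_])

instance
  ℕ-number : Number ℕ
  ℕ-number = ℕ.number

act-length : ∀ p w → length (act p w) ≡ length w
act-length p []      = refl
act-length p (x ∷ w) = cong suc (act-length _ w)

act-comp : ∀ p q w → act (comp p q) w ≡ act q (act p w)
act-comp p q []      = refl
act-comp p q (x ∷ w) = cong₂ _∷_ (sym (xor-assoc x (p []) (q []))) (act-comp _ _ w)

comp-portrait : ∀ p q w → comp p q w ≡ p w xor q (act p w)
comp-portrait p q []      = refl
comp-portrait p q (x ∷ w) = comp-portrait _ _ w

act-inv-act : ∀ p w → act (inv p) (act p w) ≡ w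
act-inv-act p []          = refl
act-inv-act p (false ∷ w) with p []
... | false = cong (false ∷_) (act-inv-act _ w)
... | true  = cong (false ∷_) (act-inv-act _ w)
act-inv-act p (true ∷ w) with p []
... | false = cong (true ∷_) (act-inv-act _ w)
... | true  = cong (true ∷_) (act-inv-act _ w)

act-inv-inv : ∀ p w → act (inv (inv p)) w ≡ act p w
act-inv-inv p w = begin
  act (inv (inv p)) w                           ≡⟨ cong (act (inv (inv p))) (act-inv-act p w) ⟨
  act (inv (inv p)) (act (inv p) (act p w))     ≡⟨ act-inv-act (inv p) (act p w) ⟩
  act p w                                       ∎
  where open ≡-Reasoning

act-act-inv : ∀ p w → act p (act (inv p) w) ≡ w
act-act-inv p w = trans (sym (act-inv-inv p (act (inv p) w))) (act-inv-act (inv p) w)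

act-injective : ∀ p {v w} → act p v ≡ act p w → v ≡ w
act-injective p {v} {w} eq = begin
  v                       ≡⟨ act-inv-act p v ⟨
  act (inv p) (act p v)   ≡⟨ cong (act (inv p)) eq ⟩
  act (inv p) (act p w)   ≡⟨ act-inv-act p w ⟩
  w                       ∎
  where open ≡-Reasoning

act-idA : ∀ w → act idA w ≡ w
act-idA []          = refl
act-idA (false ∷ w) = cong (false ∷_) (act-idA w)
act-idA (true ∷ w)  = cong (true ∷_) (act-idA w)

act-cong : ∀ p q w → (∀ v → length v ℕ.< length w → p v ≡ q v) → act p w ≡ act q w
act-cong p q []      _     = refl
act-cong p q (x ∷ w) p≗q = cong₂ _∷_ (cong (x xor_) (p≗q [] (s≤s z≤n)))
                                     (act-cong _ _ w (λ v v<w → p≗q (x ∷ v) (s≤s v<w)))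

act-++ : ∀ p v u → act p (v ++ u) ≡ act p v ++ act (λ y → p (v ++ y)) u
act-++ p []      u = refl
act-++ p (x ∷ v) u = cong ((x xor p []) ∷_) (act-++ _ v u)

portrait-from-act : ∀ p q v → act p (v ++ [ false ]) ≡ act q (v ++ [ false ]) → p v ≡ q v
portrait-from-act p q v eq = List.∷ʳ-injectiveʳ (act p v) (act q v) (begin
  act p v ++ [ p v ]               ≡⟨ cong (λ u → act p v ++ [ p u ]) (List.++-identityʳ v) ⟨
  act p v ++ [ p (v ++ []) ]       ≡⟨ act-++ p v [ false ] ⟨
  act p (v ++ [ false ])           ≡⟨ eq ⟩
  act q (v ++ [ false ])           ≡⟨ act-++ q v [ false ] ⟩
  act q v ++ [ q (v ++ []) ]       ≡⟨ cong (λ u → act q v ++ [ q u ]) (List.++-identityʳ v) ⟩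
  act q v ++ [ q v ]               ∎)
  where open ≡-Reasoning

length-zeros++ : ∀ r w → length (replicate r false ++ w) ≡ r ℕ.+ length w
length-zeros++ r w = trans (List.length-++ (replicate r false)) (cong (ℕ._+ length w) (List.length-replicate r))

iter-+ : ∀ {A : Set} (f : A → A) s t x → iter f (s ℕ.+ t) x ≡ iter f s (iter f t x)
iter-+ f zero    t x = refl
iter-+ f (suc s) t x = cong f (iter-+ f s t x)

iter-* : ∀ {A : Set} (f : A → A) c {t x} → iter f t x ≡ x → iter f (c ℕ.* t) x ≡ x
iter-* f zero    _      = refl
iter-* f (suc c) {t} {x} period = begin
  iter f (t ℕ.+ c ℕ.* t) x      ≡⟨ iter-+ f t (c ℕ.* t) x ⟩
  iter f t (iter f (c ℕ.* t) x) ≡⟨ cong (iter f t) (iter-* f c period) ⟩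
  iter f t x                    ≡⟨ period ⟩
  x                             ∎
  where open ≡-Reasoning

iter-∘ : ∀ {A : Set} (f : A → A) n x → iter (f ∘ f) n x ≡ iter f (2 ℕ.* n) x
iter-∘ f zero    x = refl
iter-∘ f (suc n) x = begin
  f (f (iter (f ∘ f) n x))       ≡⟨ cong (f ∘ f) (iter-∘ f n x) ⟩
  f (f (iter f (2 ℕ.* n) x))     ≡⟨ cong f (iter-+ f 1 (2 ℕ.* n) x) ⟨
  f (iter f (1 ℕ.+ 2 ℕ.* n) x)   ≡⟨ cong (λ s → iter f s x) (ℕ.*-suc 2 n) ⟨
  iter f (2 ℕ.* suc n) x         ∎
  where open ≡-Reasoning

iter-act-length : ∀ p t w → length (iter (act p) t w) ≡ length w
iter-act-length p zero    w = refl
iter-act-length p (suc t) w = trans (act-length p (iter (act p) t w)) (iter-act-length p t w)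

natPow-act : ∀ p N w → act (natPow p N) w ≡ iter (act p) N w
natPow-act p zero    w = act-idA w
natPow-act p (suc N) w = trans (act-comp (natPow p N) p w) (cong (act p) (natPow-act p N w))

ℕ-parity : ∀ n → (∃ λ t → n ≡ 2 ℕ.* t) ⊎ (∃ λ t → n ≡ 1 ℕ.+ 2 ℕ.* t)
ℕ-parity n with n ℕ.% 2 | ℕ.m≡m%n+[m/n]*n n 2 | ℕ.m%n<n n 2
... | 0           | n≡ | _ = inj₁ (n ℕ./ 2 , trans n≡ (ℕ.*-comm (n ℕ./ 2) 2))
... | 1           | n≡ | _ = inj₂ (n ℕ./ 2 , trans n≡ (cong suc (ℕ.*-comm (n ℕ./ 2) 2)))
... | suc (suc _) | _  | s≤s (s≤s ())

-- An odd period s together with the period 2^(e+2) yields the period 2^(e+1), since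
-- 2^(e+1) s ≡ 2^(e+1) (mod 2^(e+2)); an even period is a period of f ∘ f.
2^-minimal-period : ∀ {A : Set} (f : A → A) {x} e → iter f (2 ℕ.^ suc e) x ≡ x → iter f (2 ℕ.^ e) x ≢ x
                  → ∀ s → 0 ℕ.< s → s ℕ.< 2 ℕ.^ suc e → iter f s x ≢ x
2^-minimal-period f zero    _ not-half (suc zero)    _ _               = not-half
2^-minimal-period f zero    _ _        (suc (suc s)) _ (s≤s (s≤s ()))
2^-minimal-period f {x} (suc e) period not-half s 0<s s<2^e+2 fixed with ℕ-parity s
... | inj₁ (t , refl) =
  2^-minimal-period (f ∘ f) e (trans (iter-∘ f (2 ℕ.^ suc e) x) period) (not-half ∘ trans (sym (iter-∘ f (2 ℕ.^ e) x)))
                    t (ℕ.*-cancelˡ-< 2 0 t 0<s) (ℕ.*-cancelˡ-< 2 t _ s<2^e+2) (trans (iter-∘ f t x) fixed)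
... | inj₂ (t , refl) = not-half (begin
  iter f P x                              ≡⟨ cong (iter f P) (iter-* f t period) ⟨
  iter f P (iter f (t ℕ.* (2 ℕ.* P)) x)   ≡⟨ iter-+ f P (t ℕ.* (2 ℕ.* P)) x ⟨
  iter f (P ℕ.+ t ℕ.* (2 ℕ.* P)) x        ≡⟨ cong (λ n → iter f n x) (lemma P t) ⟩
  iter f (P ℕ.* (1 ℕ.+ 2 ℕ.* t)) x        ≡⟨ iter-* f P fixed ⟩
  x                                       ∎)
  where
    open ≡-Reasoning
    P : ℕ
    P = 2 ℕ.^ suc e
    lemma : ∀ p t → p ℕ.+ t ℕ.* (2 ℕ.* p) ≡ p ℕ.* (1 ℕ.+ 2 ℕ.* t)
    lemma = ℕ.solve-∀

-- Intertwining automorphisms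

Intertwines : Aut → Aut → Aut → Set
Intertwines c p q = ∀ w → act c (act p w) ≡ act q (act c w)

module _ {c p q : Aut} (c∘p≡q∘c : Intertwines c p q) where

  intertwines-inv : Intertwines (inv c) q p
  intertwines-inv w = begin
    act (inv c) (act q w)                         ≡⟨ cong (act (inv c) ∘ act q) (act-act-inv c w) ⟨
    act (inv c) (act q (act c (act (inv c) w)))   ≡⟨ cong (act (inv c)) (c∘p≡q∘c (act (inv c) w)) ⟨
    act (inv c) (act c (act p (act (inv c) w)))   ≡⟨ act-inv-act c (act p (act (inv c) w)) ⟩
    act p (act (inv c) w)                         ∎
    where open ≡-Reasoning

  intertwines⇒conjugate : Conjugate q p
  intertwines⇒conjugate = inv c , λ w → begin
    act (comp (comp (inv (inv c)) q) (inv c)) w   ≡⟨ act-comp (comp (inv (inv c)) q) (inv c) w ⟩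
    act (inv c) (act (comp (inv (inv c)) q) w)    ≡⟨ cong (act (inv c)) (act-comp (inv (inv c)) q w) ⟩
    act (inv c) (act q (act (inv (inv c)) w))     ≡⟨ cong (act (inv c) ∘ act q) (act-inv-inv c w) ⟩
    act (inv c) (act q (act c w))                 ≡⟨ intertwines-inv (act c w) ⟩
    act p (act (inv c) (act c w))                 ≡⟨ cong (act p) (act-inv-act c w) ⟩
    act p w                                       ∎
    where open ≡-Reasoning

  iter-intertwines : ∀ t x → act c (iter (act p) t x) ≡ iter (act q) t (act c x)
  iter-intertwines zero    x = refl
  iter-intertwines (suc t) x = trans (c∘p≡q∘c (iter (act p) t x)) (cong (act q) (iter-intertwines t x))

  orbitLen-transport : ∀ {x t} → OrbitLen p x t → OrbitLen q (act c x) t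
  orbitLen-transport {x} {t} (0<t , period , minimal) =
    0<t , trans (sym (iter-intertwines t x)) (cong (act c) period) ,
    λ s 0<s s<t fixed → minimal s 0<s s<t (act-injective c (trans (iter-intertwines s x) fixed))

  stable-transport : ∀ v → Stable p v → Stable q (act c v)
  stable-transport v (k′ , orbit-v , orbits-above) = k′ , orbitLen-transport orbit-v , orbits-above′
    where
      orbits-above′ : ∀ u → 1 ℕ.≤ length u → OrbitLen q (act c v ++ u) (2 ℕ.^ length u ℕ.* k′)
      orbits-above′ u 1≤u = subst₂ (OrbitLen q) c[v++u′]≡c[v]++u (cong (λ n → 2 ℕ.^ n ℕ.* k′) |u′|≡|u|)
                              (orbitLen-transport (orbits-above u′ (subst (1 ℕ.≤_) (sym |u′|≡|u|) 1≤u)))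
        where
          open ≡-Reasoning
          u′ : Word
          u′ = act (λ y → inv c (act c v ++ y)) u
          |u′|≡|u| : length u′ ≡ length u
          |u′|≡|u| = act-length _ u
          c[v++u′]≡c[v]++u : act c (v ++ u′) ≡ act c v ++ u
          c[v++u′]≡c[v]++u = begin
            act c (v ++ u′)                          ≡⟨ cong (λ y → act c (y ++ u′)) (act-inv-act c v) ⟨
            act c (act (inv c) (act c v) ++ u′)      ≡⟨ cong (act c) (act-++ (inv c) (act c v) u) ⟨
            act c (act (inv c) (act c v ++ u))       ≡⟨ act-act-inv c (act c v ++ u) ⟩
            act c v ++ u                             ∎

nonStableCount-transport : ∀ {c p q n s} → Intertwines c p q → NonStableCount p n s → NonStableCount q n s
nonStableCount-transport {c} {p} {q} {n} c∘p≡q∘c (L , unique , lengths , |L|≡s , characterised) =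
  map (act c) L ,
  Unique.map⁺ (act-injective c) unique ,
  All.map⁺ (All.map (λ {v} |v|≡n → trans (act-length c v) |v|≡n) lengths) ,
  trans (List.length-map (act c) L) |L|≡s ,
  characterised′
  where
    characterised′ : ∀ v → length v ≡ n → (v ∈ map (act c) L → ¬ Stable q v) × (¬ Stable q v → v ∈ map (act c) L)
    characterised′ v |v|≡n = listed⇒unstable , unstable⇒listed
      where
        listed⇒unstable : v ∈ map (act c) L → ¬ Stable q v
        listed⇒unstable v∈ stable with ∈-map⁻ (act c) v∈
        ... | x , x∈L , refl = proj₁ (characterised x (trans (sym (act-length c x)) |v|≡n)) x∈L
          (subst (Stable p) (act-inv-act c x) (stable-transport (intertwines-inv c∘p≡q∘c) (act c x) stable))

        c[c⁻¹v]≡v : act c (act (inv c) v) ≡ v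
        c[c⁻¹v]≡v = act-act-inv c v

        unstable⇒listed : ¬ Stable q v → v ∈ map (act c) L
        unstable⇒listed unstable = subst (_∈ map (act c) L) c[c⁻¹v]≡v (∈-map⁺ (act c)
          (proj₂ (characterised (act (inv c) v) (trans (act-length (inv c) v) |v|≡n))
                 (λ stable → unstable (subst (Stable q) c[c⁻¹v]≡v (stable-transport c∘p≡q∘c (act (inv c) v) stable)))))

-- Integer arithmetic; its operator names clash with ℕ's, so it is opened only in this block.

module _ where
  open import Data.Integer as ℤ using (ℤ; +_; _+_; _-_; _*_; -_; _^_)
  import Data.Integer.Literals as ℤ
  import Data.Integer.Properties as ℤ
  open import Data.Integer.Divisibility.Signed
  open import Data.Integer.DivMod using (_%_; _/_; a≡a%n+[a/n]*n; n%d<d)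
  open import Data.Integer.Tactic.RingSolver using (solve-∀)
  open import Level using (0ℓ)
  open import Relation.Binary.Bundles using (Setoid)
  import Relation.Binary.Reasoning.Setoid
  open import Relation.Binary.Structures using (IsEquivalence)

  instance
    ℤ-number : Number ℤ
    ℤ-number = ℤ.number

  infix 4 _≡_[mod_]

  record _≡_[mod_] (x y d : ℤ) : Set where
    constructor from-∣
    field to-∣ : d ∣ x - y


  module _ {d : ℤ} where

    mod-reflexive : ∀ {x y} → x ≡ y → x ≡ y [mod d ]
    mod-reflexive {x} refl = from-∣ (divides 0 (lemma x d))
      where lemma : ∀ x d → x - x ≡ 0 * d
            lemma = solve-∀

    mod-refl : ∀ {x} → x ≡ x [mod d ]
    mod-refl = mod-reflexive refl

    mod-sym : ∀ {x y} → x ≡ y [mod d ] → y ≡ x [mod d ]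
    mod-sym {x} {y} (from-∣ p) = from-∣ (subst (d ∣_) (lemma x y) (∣m⇒∣-m p))
      where lemma : ∀ x y → - (x - y) ≡ y - x
            lemma = solve-∀

    mod-trans : ∀ {x y z} → x ≡ y [mod d ] → y ≡ z [mod d ] → x ≡ z [mod d ]
    mod-trans {x} {y} {z} (from-∣ p) (from-∣ q) = from-∣ (subst (d ∣_) (lemma x y z) (∣m∣n⇒∣m+n p q))
      where lemma : ∀ x y z → x - y + (y - z) ≡ x - z
            lemma = solve-∀

    mod-+ : ∀ {x y u v} → x ≡ y [mod d ] → u ≡ v [mod d ] → x + u ≡ y + v [mod d ]
    mod-+ {x} {y} {u} {v} (from-∣ p) (from-∣ q) = from-∣ (subst (d ∣_) (lemma x y u v) (∣m∣n⇒∣m+n p q))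
      where lemma : ∀ x y u v → x - y + (u - v) ≡ x + u - (y + v)
            lemma = solve-∀

    mod-sub : ∀ {x y u v} → x ≡ y [mod d ] → u ≡ v [mod d ] → x - u ≡ y - v [mod d ]
    mod-sub {x} {y} {u} {v} (from-∣ p) (from-∣ q) = from-∣ (subst (d ∣_) (lemma x y u v) (∣m∣n⇒∣m-n p q))
      where lemma : ∀ x y u v → x - y - (u - v) ≡ x - u - (y - v)
            lemma = solve-∀

    mod-+ˡ : ∀ c {x y} → x ≡ y [mod d ] → c + x ≡ c + y [mod d ]
    mod-+ˡ c = mod-+ (mod-refl {c})

    mod-+ʳ : ∀ c {x y} → x ≡ y [mod d ] → x + c ≡ y + c [mod d ]
    mod-+ʳ c p = mod-+ p (mod-refl {c})

    mod-subˡ : ∀ c {x y} → x ≡ y [mod d ] → c - x ≡ c - y [mod d ]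
    mod-subˡ c = mod-sub (mod-refl {c})

    mod-subʳ : ∀ c {x y} → x ≡ y [mod d ] → x - c ≡ y - c [mod d ]
    mod-subʳ c p = mod-sub p (mod-refl {c})

    mod-*ˡ : ∀ c {x y} → x ≡ y [mod d ] → c * x ≡ c * y [mod d ]
    mod-*ˡ c {x} {y} (from-∣ p) = from-∣ (subst (d ∣_) (lemma c x y) (∣n⇒∣m*n c p))
      where lemma : ∀ c x y → c * (x - y) ≡ c * x - c * y
            lemma = solve-∀

    +-multiple-mod : ∀ x q → x + q * d ≡ x [mod d ]
    +-multiple-mod x q = from-∣ (divides q (lemma x q d))
      where lemma : ∀ x q d → x + q * d - x ≡ q * d
            lemma = solve-∀

    mod-isEquivalence : IsEquivalence (λ x y → x ≡ y [mod d ])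
    mod-isEquivalence = record { refl = mod-refl ; sym = mod-sym ; trans = mod-trans }

  mod-setoid : ℤ → Setoid 0ℓ 0ℓ
  mod-setoid d = record { isEquivalence = mod-isEquivalence {d} }

  module ≡-mod-Reasoning (d : ℤ) = Relation.Binary.Reasoning.Setoid (mod-setoid d)

  mod-1 : ∀ {x y} → x ≡ y [mod 1 ]
  mod-1 {x} {y} = from-∣ (divides (x - y) (sym (ℤ.*-identityʳ (x - y))))

  mod-cancel-+ˡ : ∀ c {d x y} → c + x ≡ c + y [mod d ] → x ≡ y [mod d ]
  mod-cancel-+ˡ c {d} {x} {y} (from-∣ p) = from-∣ (subst (d ∣_) (lemma c x y) p)
    where lemma : ∀ c x y → c + x - (c + y) ≡ x - y
          lemma = solve-∀

  mod-∣ : ∀ {e d x y} → e ∣ d → x ≡ y [mod d ] → x ≡ y [mod e ]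
  mod-∣ e∣d (from-∣ p) = from-∣ (∣-trans e∣d p)

  mod-scale : ∀ c {d x y} → x ≡ y [mod d ] → c * x ≡ c * y [mod c * d ]
  mod-scale c {d} {x} {y} (from-∣ p) = from-∣ (subst (c * d ∣_) (lemma c x y) (*-monoʳ-∣ c p))
    where lemma : ∀ c x y → c * (x - y) ≡ c * x - c * y
          lemma = solve-∀

  mod-unscale : ∀ c .{{_ : ℤ.NonZero c}} {d x y} → c * x ≡ c * y [mod c * d ] → x ≡ y [mod d ]
  mod-unscale c {d} {x} {y} (from-∣ p) = from-∣ (*-cancelˡ-∣ c (subst (c * d ∣_) (lemma c x y) p))
    where lemma : ∀ c x y → c * x - c * y ≡ c * (x - y)
          lemma = solve-∀

  2^-nonZero : ∀ n → ℤ.NonZero (2 ^ n)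
  2^-nonZero n = ℤ.≢-nonZero (λ 2^n≡0 → case ℤ.i^n≡0⇒i≡0 2 n 2^n≡0 of λ ())

  2^-∣ : ∀ {n N} → n ℕ.≤ N → 2 ^ n ∣ 2 ^ N
  2^-∣ {n} n≤N with ℕ.m≤n⇒∃[o]m+o≡n n≤N
  ... | j , refl = divides (2 ^ j) (trans (ℤ.^-distribˡ-+-* 2 n j) (ℤ.*-comm (2 ^ n) (2 ^ j)))

  mod-2^-≤ : ∀ {n N x y} → n ℕ.≤ N → x ≡ y [mod 2 ^ N ] → x ≡ y [mod 2 ^ n ]
  mod-2^-≤ n≤N = mod-∣ (2^-∣ n≤N)

  Odd : ℤ → Set
  Odd x = ∃ λ t → x ≡ 1 + 2 * t

  odd-* : ∀ {x y} → Odd x → Odd y → Odd (x * y)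
  odd-* (s , refl) (t , refl) = s + t + 2 * s * t , lemma s t
    where lemma : ∀ s t → (1 + 2 * s) * (1 + 2 * t) ≡ 1 + 2 * (s + t + 2 * s * t)
          lemma = solve-∀

  odd-^ : ∀ {x} → Odd x → ∀ t → Odd (x ^ t)
  odd-^ odd-x zero    = 0 , refl
  odd-^ odd-x (suc t) = odd-* odd-x (odd-^ odd-x t)

  odd⇒¬2∣ : ∀ {x} → Odd x → ¬ 2 ∣ x
  odd⇒¬2∣ (t , refl) 2∣x = case ℕ.∣1⇒≡1 (∣⇒∣ᵤ (∣m+n∣n⇒∣m {m = 1} 2∣x (∣m⇒∣m*n t ∣-refl))) of λ ()

  ℤ-parity : ∀ x → (∃ λ t → x ≡ 2 * t) ⊎ Odd x
  ℤ-parity x with x % 2 | a≡a%n+[a/n]*n x 2 | n%d<d x 2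
  ... | 0 | x≡ | _ = inj₁ (x / 2 , trans x≡ (lemma (x / 2)))
    where lemma : ∀ q → 0 + q * 2 ≡ 2 * q
          lemma = solve-∀
  ... | 1 | x≡ | _ = inj₂ (x / 2 , trans x≡ (lemma (x / 2)))
    where lemma : ∀ q → 1 + q * 2 ≡ 1 + 2 * q
          lemma = solve-∀
  ... | suc (suc _) | _ | s≤s (s≤s ())

  odd-cancel-∣ : ∀ {o x} → Odd o → ∀ n → 2 ^ n ∣ o * x → 2 ^ n ∣ x
  odd-cancel-∣ {x = x} odd-o zero _ = divides x (sym (ℤ.*-identityʳ x))
  odd-cancel-∣ {o} {x} odd-o (suc n) 2^n∣ox with ℤ-parity x
  ... | inj₂ odd-x = contradiction (∣-trans (∣m⇒∣m*n (2 ^ n) ∣-refl) 2^n∣ox) (odd⇒¬2∣ (odd-* odd-o odd-x))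
  ... | inj₁ (t , refl) = *-monoʳ-∣ 2 (odd-cancel-∣ odd-o n (*-cancelˡ-∣ 2 (subst (2 ^ suc n ∣_) (lemma o t) 2^n∣ox)))
    where lemma : ∀ o t → o * (2 * t) ≡ 2 * (o * t)
          lemma = solve-∀

  mod-odd-cancel : ∀ {o x y} n → Odd o → o * x ≡ o * y [mod 2 ^ n ] → x ≡ y [mod 2 ^ n ]
  mod-odd-cancel {o} {x} {y} n odd-o (from-∣ p) = from-∣ (odd-cancel-∣ odd-o n (subst (2 ^ n ∣_) (lemma o x y) p))
    where lemma : ∀ o x y → o * x - o * y ≡ o * (x - y)
          lemma = solve-∀

  even≢odd-mod : ∀ {d} x y → ¬ 0 + 2 * x ≡ 1 + 2 * y [mod 2 * d ]
  even≢odd-mod {d} x y (from-∣ p) = odd⇒¬2∣ (x - y - 1 , lemma x y) (∣-trans (∣m⇒∣m*n d ∣-refl) p)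
    where lemma : ∀ x y → 0 + 2 * x - (1 + 2 * y) ≡ 1 + 2 * (x - y - 1)
          lemma = solve-∀

  -- Vertices as residues modulo 2ⁿ

  bit : Bool → ℤ
  bit false = 0
  bit true  = 1

  ⟦_⟧ : Word → ℤ
  ⟦ []    ⟧ = 0
  ⟦ b ∷ w ⟧ = bit b + 2 * ⟦ w ⟧

  ⟦⟧-injective : ∀ {n} v w → length v ≡ n → length w ≡ n → ⟦ v ⟧ ≡ ⟦ w ⟧ [mod 2 ^ n ] → v ≡ w
  ⟦⟧-injective []          []          refl refl _ = refl
  ⟦⟧-injective (false ∷ v) (false ∷ w) refl |w| v≡w =
    cong (false ∷_) (⟦⟧-injective v w refl (ℕ.suc-injective |w|) (mod-unscale 2 (mod-cancel-+ˡ 0 v≡w)))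
  ⟦⟧-injective (true ∷ v)  (true ∷ w)  refl |w| v≡w =
    cong (true ∷_) (⟦⟧-injective v w refl (ℕ.suc-injective |w|) (mod-unscale 2 (mod-cancel-+ˡ 1 v≡w)))
  ⟦⟧-injective (false ∷ v) (true ∷ w)  refl _ v≡w = ⊥-elim (even≢odd-mod ⟦ v ⟧ ⟦ w ⟧ v≡w)
  ⟦⟧-injective (true ∷ v)  (false ∷ w) refl _ v≡w = ⊥-elim (even≢odd-mod ⟦ w ⟧ ⟦ v ⟧ (mod-sym v≡w))

  ⟦replicate-false⟧ : ∀ r w → ⟦ replicate r false ++ w ⟧ ≡ 2 ^ r * ⟦ w ⟧
  ⟦replicate-false⟧ zero    w = sym (ℤ.*-identityˡ ⟦ w ⟧)
  ⟦replicate-false⟧ (suc r) w = trans (cong (λ x → 0 + 2 * x) (⟦replicate-false⟧ r w)) (lemma (2 ^ r) ⟦ w ⟧)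
    where lemma : ∀ p x → 0 + 2 * (p * x) ≡ 2 * p * x
          lemma = solve-∀

  infix 8 _↾_

  _↾_ : ℤ₂ → ℕ → ℤ
  c ↾ n = + trunc c n

  shift : ℕ → ℤ₂ → ℤ₂
  shift j c i = c (j ℕ.+ i)

  pos-2^ : ∀ n → + (2 ℕ.^ n) ≡ 2 ^ n
  pos-2^ zero    = refl
  pos-2^ (suc n) = trans (ℤ.pos-* 2 (2 ℕ.^ n)) (cong (2 *_) (pos-2^ n))

  ↾-top : ∀ c n → c ↾ suc n ≡ c ↾ n + bit (c n) * 2 ^ n
  ↾-top c n with c n
  ... | false = refl
  ... | true  = cong (_+_ (c ↾ n)) (trans (pos-2^ n) (sym (ℤ.*-identityˡ (2 ^ n))))

  ↾-congruent : ∀ c {n N} → n ℕ.≤ N → c ↾ N ≡ c ↾ n [mod 2 ^ n ]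
  ↾-congruent c n≤N = go (ℕ.≤⇒≤′ n≤N)
    where
      go : ∀ {n N} → n ℕ.≤′ N → c ↾ N ≡ c ↾ n [mod 2 ^ n ]
      go ℕ.≤′-refl                 = mod-refl
      go {n} (ℕ.≤′-step {N} n≤′N) =
        mod-trans (mod-2^-≤ (ℕ.≤′⇒≤ n≤′N) (mod-trans (mod-reflexive (↾-top c N)) (+-multiple-mod (c ↾ N) (bit (c N)))))
                  (go n≤′N)

  ↾-suc : ∀ c N → c ↾ suc N ≡ bit (c 0) + 2 * (half c ↾ N)
  ↾-suc c zero    = trans (↾-top c 0) (lemma (bit (c 0)))
    where lemma : ∀ b → 0 + b * 1 ≡ b + 2 * 0
          lemma = solve-∀
  ↾-suc c (suc N) = begin
    c ↾ suc (suc N)                                        ≡⟨ ↾-top c (suc N) ⟩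
    c ↾ suc N + b * (2 * 2 ^ N)                            ≡⟨ cong (_+ b * (2 * 2 ^ N)) (↾-suc c N) ⟩
    bit (c 0) + 2 * (half c ↾ N) + b * (2 * 2 ^ N)         ≡⟨ lemma (bit (c 0)) (half c ↾ N) b (2 ^ N) ⟩
    bit (c 0) + 2 * (half c ↾ N + b * 2 ^ N)               ≡⟨ cong (λ x → bit (c 0) + 2 * x) (↾-top (half c) N) ⟨
    bit (c 0) + 2 * (half c ↾ suc N)                       ∎
    where
      open ≡-Reasoning
      b : ℤ
      b = bit (c (suc N))
      lemma : ∀ b₀ t b p → b₀ + 2 * t + b * (2 * p) ≡ b₀ + 2 * (t + b * p)
      lemma = solve-∀

  ↾-shift : ∀ a c N → (∀ i → i ℕ.< a → c i ≡ false) → c ↾ (a ℕ.+ N) ≡ 2 ^ a * (shift a c ↾ N)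
  ↾-shift zero    c N _        = sym (ℤ.*-identityˡ (c ↾ N))
  ↾-shift (suc a) c N low-zero = begin
    c ↾ suc (a ℕ.+ N)                              ≡⟨ ↾-suc c (a ℕ.+ N) ⟩
    bit (c 0) + 2 * (half c ↾ (a ℕ.+ N))           ≡⟨ cong (λ b → bit b + 2 * (half c ↾ (a ℕ.+ N))) (low-zero 0 (s≤s z≤n)) ⟩
    0 + 2 * (half c ↾ (a ℕ.+ N))                   ≡⟨ cong (λ x → 0 + 2 * x) (↾-shift a (half c) N (λ i i<a → low-zero (suc i) (s≤s i<a))) ⟩
    0 + 2 * (2 ^ a * (shift (suc a) c ↾ N))        ≡⟨ lemma (2 ^ a) (shift (suc a) c ↾ N) ⟩
    2 * 2 ^ a * (shift (suc a) c ↾ N)              ∎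
    where
      open ≡-Reasoning
      lemma : ∀ p x → 0 + 2 * (p * x) ≡ 2 * p * x
      lemma = solve-∀

  ↾-suc-odd : ∀ {c} → c 0 ≡ true → ∀ N → c ↾ suc N ≡ 1 + 2 * (half c ↾ N)
  ↾-suc-odd {c} c₀ N = trans (↾-suc c N) (cong (λ b → bit b + 2 * (half c ↾ N)) c₀)

  ↾-odd : ∀ {c} → c 0 ≡ true → ∀ N → Odd (c ↾ suc N)
  ↾-odd {c} c₀ N = half c ↾ N , ↾-suc-odd c₀ N

  -- The odometer and z_k as affine maps

  act-γ : ∀ {n} w → length w ≡ n → ⟦ act gamma w ⟧ ≡ ⟦ w ⟧ - 1 [mod 2 ^ n ]
  act-γ []          refl = mod-1
  act-γ (false ∷ w) refl = begin
    1 + 2 * ⟦ act gamma w ⟧    ≈⟨ mod-+ˡ 1 (mod-scale 2 (act-γ w refl)) ⟩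
    1 + 2 * (⟦ w ⟧ - 1)        ≡⟨ lemma ⟦ w ⟧ ⟩
    0 + 2 * ⟦ w ⟧ - 1          ∎
    where
      open ≡-mod-Reasoning (2 ^ suc (length w))
      lemma : ∀ x → 1 + 2 * (x - 1) ≡ 0 + 2 * x - 1
      lemma = solve-∀
  act-γ (true ∷ w)  refl = mod-reflexive (trans (cong (λ v → 0 + 2 * ⟦ v ⟧) (act-idA w)) (lemma ⟦ w ⟧))
    where lemma : ∀ x → 0 + 2 * x ≡ 1 + 2 * x - 1
          lemma = solve-∀

  iter-γ : ∀ N {n} w → length w ≡ n → ⟦ iter (act gamma) N w ⟧ ≡ ⟦ w ⟧ - + N [mod 2 ^ n ]
  iter-γ zero    w _   = mod-reflexive (sym (ℤ.+-identityʳ ⟦ w ⟧))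
  iter-γ (suc N) {n} w |w| = begin
    ⟦ act gamma (iter (act gamma) N w) ⟧   ≈⟨ act-γ (iter (act gamma) N w) (trans (iter-act-length gamma N w) |w|) ⟩
    ⟦ iter (act gamma) N w ⟧ - 1           ≈⟨ mod-subʳ 1 (iter-γ N w |w|) ⟩
    ⟦ w ⟧ - + N - 1                        ≡⟨ lemma ⟦ w ⟧ (+ N) ⟩
    ⟦ w ⟧ - (1 + + N)                      ∎
    where
      open ≡-mod-Reasoning (2 ^ n)
      lemma : ∀ x N → x - N - 1 ≡ x - (1 + N)
      lemma = solve-∀

  iter-γ-cong : ∀ {N M n} w → length w ≡ n → + N ≡ + M [mod 2 ^ n ] → iter (act gamma) N w ≡ iter (act gamma) M w
  iter-γ-cong {N} {M} w |w| N≡M = ⟦⟧-injective _ _ (trans (iter-act-length gamma N w) |w|)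
    (trans (iter-act-length gamma M w) |w|)
    (mod-trans (iter-γ N w |w|) (mod-trans (mod-subˡ ⟦ w ⟧ N≡M) (mod-sym (iter-γ M w |w|))))

  natPow-γ-portrait : ∀ {N M} v → + N ≡ + M [mod 2 ^ suc (length v) ] → natPow gamma N v ≡ natPow gamma M v
  natPow-γ-portrait {N} {M} v N≡M = portrait-from-act (natPow gamma N) (natPow gamma M) v (begin
    act (natPow gamma N) (v ++ [ false ])   ≡⟨ natPow-act gamma N (v ++ [ false ]) ⟩
    iter (act gamma) N (v ++ [ false ])     ≡⟨ iter-γ-cong (v ++ [ false ]) |v++0| N≡M ⟩
    iter (act gamma) M (v ++ [ false ])     ≡⟨ natPow-act gamma M (v ++ [ false ]) ⟨
    act (natPow gamma M) (v ++ [ false ])   ∎)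
    where
      open ≡-Reasoning
      |v++0| : length (v ++ [ false ]) ≡ suc (length v)
      |v++0| = trans (List.length-++ v) (ℕ.+-comm (length v) 1)

  act-pow-γ : ∀ c {n} w → length w ≡ n → ⟦ act (pow gamma c) w ⟧ ≡ ⟦ w ⟧ - c ↾ n [mod 2 ^ n ]
  act-pow-γ c {n} w |w| = begin
    ⟦ act (pow gamma c) w ⟧                  ≡⟨ cong ⟦_⟧ (act-cong _ _ w portraits-agree) ⟩
    ⟦ act (natPow gamma (trunc c n)) w ⟧     ≡⟨ cong ⟦_⟧ (natPow-act gamma (trunc c n) w) ⟩
    ⟦ iter (act gamma) (trunc c n) w ⟧       ≈⟨ iter-γ (trunc c n) w |w| ⟩
    ⟦ w ⟧ - c ↾ n                            ∎
    where
      open ≡-mod-Reasoning (2 ^ n)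
      portraits-agree : ∀ v → length v ℕ.< length w → pow gamma c v ≡ natPow gamma (trunc c n) v
      portraits-agree v v<w = natPow-γ-portrait v (mod-sym (↾-congruent c (subst (suc (length v) ℕ.≤_) |w| v<w)))

  act-z-true : ∀ k w → act (z k) (true ∷ w) ≡ true ∷ act (z k) (act (pow gamma (half k)) w)
  act-z-true k w = cong (true ∷_) (trans (act-cong _ _ w (λ u _ → section u)) (act-comp (pow gamma (half k)) (z k) w))
    where
      γ^ℓ : Aut
      γ^ℓ = pow gamma (half k)
      section : ∀ u → zAt (half k) (suc (length u)) (true ∷ u) ≡ comp γ^ℓ (z k) u
      section u = begin
        comp γ^ℓ (zAt (half k) (length u)) u                      ≡⟨ comp-portrait γ^ℓ (zAt (half k) (length u)) u ⟩
        γ^ℓ u xor zAt (half k) (length u) (act γ^ℓ u)             ≡⟨ cong (λ n → γ^ℓ u xor zAt (half k) n (act γ^ℓ u)) (act-length γ^ℓ u) ⟨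
        γ^ℓ u xor z k (act γ^ℓ u)                                 ≡⟨ comp-portrait γ^ℓ (z k) u ⟨
        comp γ^ℓ (z k) u                                          ∎
        where open ≡-Reasoning

  z-divides : ∀ {k} → k 0 ≡ true → ∀ {n N} w → length w ≡ n → n ℕ.≤ N → k ↾ N * ⟦ act (z k) w ⟧ ≡ ⟦ w ⟧ [mod 2 ^ n ]
  z-divides k₀ {zero} [] _ _ = mod-1
  z-divides {k} k₀ {suc n} {suc N} (false ∷ w) |w| (s≤s n≤N) = begin
    K * (0 + 2 * ⟦ act (z k) w ⟧)    ≡⟨ lemma K ⟦ act (z k) w ⟧ ⟩
    2 * (K * ⟦ act (z k) w ⟧)        ≈⟨ mod-scale 2 (z-divides k₀ w (ℕ.suc-injective |w|) (ℕ.m≤n⇒m≤1+n n≤N)) ⟩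
    2 * ⟦ w ⟧                        ≡⟨ ℤ.+-identityˡ (2 * ⟦ w ⟧) ⟨
    0 + 2 * ⟦ w ⟧                    ∎
    where
      open ≡-mod-Reasoning (2 ^ suc n)
      K : ℤ
      K = k ↾ suc N
      lemma : ∀ K x → K * (0 + 2 * x) ≡ 2 * (K * x)
      lemma = solve-∀
  z-divides {k} k₀ {suc n} {suc N} (true ∷ w) |w| (s≤s n≤N) = begin
    K * ⟦ act (z k) (true ∷ w) ⟧                  ≡⟨ cong (λ v → K * ⟦ v ⟧) (act-z-true k w) ⟩
    K * (1 + 2 * ⟦ act (z k) G ⟧)                 ≡⟨ lemma₁ K ⟦ act (z k) G ⟧ ⟩
    K + 2 * (K * ⟦ act (z k) G ⟧)                 ≈⟨ mod-+ˡ K (mod-scale 2 (z-divides k₀ G |G| (ℕ.m≤n⇒m≤1+n n≤N))) ⟩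
    K + 2 * ⟦ G ⟧                                 ≈⟨ mod-+ˡ K (mod-scale 2 (act-pow-γ ℓ w (ℕ.suc-injective |w|))) ⟩
    K + 2 * (⟦ w ⟧ - ℓ ↾ n)                       ≡⟨ cong (_+ 2 * (⟦ w ⟧ - ℓ ↾ n)) (↾-suc-odd k₀ N) ⟩
    1 + 2 * (ℓ ↾ N) + 2 * (⟦ w ⟧ - ℓ ↾ n)         ≈⟨ mod-+ʳ (2 * (⟦ w ⟧ - ℓ ↾ n)) (mod-+ˡ 1 (mod-scale 2 (↾-congruent ℓ n≤N))) ⟩
    1 + 2 * (ℓ ↾ n) + 2 * (⟦ w ⟧ - ℓ ↾ n)         ≡⟨ lemma₂ (ℓ ↾ n) ⟦ w ⟧ ⟩
    1 + 2 * ⟦ w ⟧                                 ∎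
    where
      open ≡-mod-Reasoning (2 ^ suc n)
      ℓ : ℤ₂
      ℓ = half k
      K : ℤ
      K = k ↾ suc N
      G : Word
      G = act (pow gamma ℓ) w
      |G| : length G ≡ n
      |G| = trans (act-length (pow gamma ℓ) w) (ℕ.suc-injective |w|)
      lemma₁ : ∀ K x → K * (1 + 2 * x) ≡ K + 2 * (K * x)
      lemma₁ = solve-∀
      lemma₂ : ∀ l x → 1 + 2 * l + 2 * (x - l) ≡ 1 + 2 * x
      lemma₂ = solve-∀

  affine-action : ∀ {k} → k 0 ≡ true → ∀ c {n N} w → length w ≡ n → n ℕ.≤ N
                → k ↾ N * ⟦ act (comp (pow gamma c) (z k)) w ⟧ ≡ ⟦ w ⟧ - c ↾ n [mod 2 ^ n ]
  affine-action {k} k₀ c {n} {N} w |w| n≤N = begin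
    k ↾ N * ⟦ act (comp (pow gamma c) (z k)) w ⟧    ≡⟨ cong (λ v → k ↾ N * ⟦ v ⟧) (act-comp (pow gamma c) (z k) w) ⟩
    k ↾ N * ⟦ act (z k) (act (pow gamma c) w) ⟧     ≈⟨ z-divides k₀ (act (pow gamma c) w) (trans (act-length _ w) |w|) n≤N ⟩
    ⟦ act (pow gamma c) w ⟧                         ≈⟨ act-pow-γ c w |w| ⟩
    ⟦ w ⟧ - c ↾ n                                   ∎
    where open ≡-mod-Reasoning (2 ^ n)

  iter-z-divides : ∀ {k} → k 0 ≡ true → ∀ {n N} t y → length y ≡ n → n ℕ.≤ N
                 → (k ↾ N) ^ t * ⟦ iter (act (z k)) t y ⟧ ≡ ⟦ y ⟧ [mod 2 ^ n ]
  iter-z-divides         k₀         zero    y _   _   = mod-reflexive (ℤ.*-identityˡ ⟦ y ⟧)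
  iter-z-divides {k} k₀ {n} {N} (suc t) y |y| n≤N = begin
    K * K ^ t * ⟦ act (z k) Y ⟧     ≡⟨ lemma K (K ^ t) ⟦ act (z k) Y ⟧ ⟩
    K ^ t * (K * ⟦ act (z k) Y ⟧)   ≈⟨ mod-*ˡ (K ^ t) (z-divides k₀ Y (trans (iter-act-length (z k) t y) |y|) n≤N) ⟩
    K ^ t * ⟦ Y ⟧                   ≈⟨ iter-z-divides k₀ t y |y| n≤N ⟩
    ⟦ y ⟧                           ∎
    where
      open ≡-mod-Reasoning (2 ^ n)
      K : ℤ
      K = k ↾ N
      Y : Word
      Y = iter (act (z k)) t y
      lemma : ∀ K L x → K * L * x ≡ L * (K * x)
      lemma = solve-∀

  z-period⇒ : ∀ {k} → k 0 ≡ true → ∀ {n N} t y → length y ≡ n → n ℕ.≤ N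
            → iter (act (z k)) t y ≡ y → (k ↾ N) ^ t * ⟦ y ⟧ ≡ ⟦ y ⟧ [mod 2 ^ n ]
  z-period⇒ {k} k₀ {n} {N} t y |y| n≤N period =
    subst (λ v → (k ↾ N) ^ t * ⟦ v ⟧ ≡ ⟦ y ⟧ [mod 2 ^ n ]) period (iter-z-divides k₀ t y |y| n≤N)

  z-period⇐ : ∀ {k} → k 0 ≡ true → ∀ {n N} t y → length y ≡ n → n ℕ.≤ N → 1 ℕ.≤ N
            → (k ↾ N) ^ t * ⟦ y ⟧ ≡ ⟦ y ⟧ [mod 2 ^ n ] → iter (act (z k)) t y ≡ y
  z-period⇐ {k} k₀ {n} {suc N} t y |y| n≤N _ K^t-fixes =
    ⟦⟧-injective _ y (trans (iter-act-length (z k) t y) |y|) |y|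
      (mod-odd-cancel n (odd-^ (↾-odd k₀ N) t) (mod-trans (iter-z-divides k₀ t y |y| n≤N) (mod-sym K^t-fixes)))

  square-lift : ∀ {j O} → 2 ℕ.≤ j → Odd O → ∃ λ O′ → Odd O′ × (1 + 2 ^ j * O) * (1 + 2 ^ j * O) ≡ 1 + 2 ^ suc j * O′
  square-lift {suc (suc i)} {O} (s≤s (s≤s z≤n)) odd-O = O * (1 + 2 * (2 ^ i * O)) , odd-* odd-O (2 ^ i * O , refl) , lemma (2 ^ i) O
    where lemma : ∀ p O → (1 + 2 * (2 * p) * O) * (1 + 2 * (2 * p) * O) ≡ 1 + 2 * (2 * (2 * p)) * (O * (1 + 2 * (p * O)))
          lemma = solve-∀

  -- 2 ≤ s is needed: 3² ≡ 1 (mod 8).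
  lifting-the-exponent : ∀ {s O} → 2 ℕ.≤ s → Odd O → ∀ e
                       → ∃ λ O′ → Odd O′ × (1 + 2 ^ s * O) ^ (2 ℕ.^ e) ≡ 1 + 2 ^ (s ℕ.+ e) * O′
  lifting-the-exponent {s} {O} _ odd-O zero =
    O , odd-O , trans (ℤ.*-identityʳ _) (cong (λ j → 1 + 2 ^ j * O) (sym (ℕ.+-identityʳ s)))
  lifting-the-exponent {s} {O} 2≤s odd-O (suc e)
    with lifting-the-exponent 2≤s odd-O e
  ... | Oₑ , odd-Oₑ , x^2^e≡ with square-lift (ℕ.≤-trans 2≤s (ℕ.m≤m+n s e)) odd-Oₑ
  ... | O′ , odd-O′ , square≡ = O′ , odd-O′ , (begin
    x ^ (2 ℕ.^ e ℕ.+ (2 ℕ.^ e ℕ.+ 0))                   ≡⟨ ℤ.^-distribˡ-+-* x (2 ℕ.^ e) (2 ℕ.^ e ℕ.+ 0) ⟩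
    x ^ (2 ℕ.^ e) * x ^ (2 ℕ.^ e ℕ.+ 0)                 ≡⟨ cong (λ j → x ^ (2 ℕ.^ e) * x ^ j) (ℕ.+-identityʳ (2 ℕ.^ e)) ⟩
    x ^ (2 ℕ.^ e) * x ^ (2 ℕ.^ e)                       ≡⟨ cong₂ _*_ x^2^e≡ x^2^e≡ ⟩
    (1 + 2 ^ (s ℕ.+ e) * Oₑ) * (1 + 2 ^ (s ℕ.+ e) * Oₑ) ≡⟨ square≡ ⟩
    1 + 2 ^ suc (s ℕ.+ e) * O′                          ≡⟨ cong (λ j → 1 + 2 ^ j * O′) (ℕ.+-suc s e) ⟨
    1 + 2 ^ (s ℕ.+ suc e) * O′                          ∎)
    where
      open ≡-Reasoning
      x : ℤ
      x = 1 + 2 ^ s * O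

  unit-difference : ∀ r j O u → (1 + 2 ^ j * O) * (2 ^ r * u) - 2 ^ r * u ≡ 2 ^ (r ℕ.+ j) * (O * u)
  unit-difference r j O u = begin
    (1 + 2 ^ j * O) * (2 ^ r * u) - 2 ^ r * u     ≡⟨ lemma (2 ^ r) (2 ^ j) O u ⟩
    2 ^ r * 2 ^ j * (O * u)                       ≡⟨ cong (_* (O * u)) (ℤ.^-distribˡ-+-* 2 r j) ⟨
    2 ^ (r ℕ.+ j) * (O * u)                       ∎
    where
      open ≡-Reasoning
      lemma : ∀ p q O u → (1 + q * O) * (p * u) - p * u ≡ p * q * (O * u)
      lemma = solve-∀

  unit-fixes : ∀ r j O u → (1 + 2 ^ j * O) * (2 ^ r * u) ≡ 2 ^ r * u [mod 2 ^ (r ℕ.+ j) ]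
  unit-fixes r j O u = from-∣ (divides (O * u) (trans (unit-difference r j O u) (ℤ.*-comm (2 ^ (r ℕ.+ j)) (O * u))))

  unit-moves : ∀ r j {O u} → Odd O → Odd u → ¬ (1 + 2 ^ j * O) * (2 ^ r * u) ≡ 2 ^ r * u [mod 2 ^ suc (r ℕ.+ j) ]
  unit-moves r j {O} {u} odd-O odd-u (from-∣ 2^[1+r+j]∣) =
    odd⇒¬2∣ (odd-* odd-O odd-u) (*-cancelˡ-∣ (2 ^ (r ℕ.+ j)) {{2^-nonZero (r ℕ.+ j)}}
      (subst₂ _∣_ (ℤ.*-comm 2 (2 ^ (r ℕ.+ j))) (unit-difference r j O u) 2^[1+r+j]∣))

  n≤m+[1+n] : ∀ m n → n ℕ.≤ m ℕ.+ suc n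
  n≤m+[1+n] m n = ℕ.≤-trans (ℕ.n≤1+n n) (ℕ.m≤n+m (suc n) m)

  -- The case k = 1 + 2^(a+1) ℓ′ with ℓ′ odd

  module _ {k : ℤ₂} {a : ℕ} (k₀ : k 0 ≡ true) (v₂ℓ≡a : HasVal (half k) a) where

    ℓ′ : ℤ₂
    ℓ′ = shift a (half k)

    ℓ′₀ : ℓ′ 0 ≡ true
    ℓ′₀ = trans (cong (half k) (ℕ.+-identityʳ a)) (proj₂ v₂ℓ≡a)

    k-decomposition : ∀ N → k ↾ (suc a ℕ.+ N) ≡ 1 + 2 ^ suc a * (ℓ′ ↾ N)
    k-decomposition N = begin
      k ↾ suc (a ℕ.+ N)                 ≡⟨ ↾-suc-odd k₀ (a ℕ.+ N) ⟩
      1 + 2 * (half k ↾ (a ℕ.+ N))      ≡⟨ cong (λ x → 1 + 2 * x) (↾-shift a (half k) N (proj₁ v₂ℓ≡a)) ⟩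
      1 + 2 * (2 ^ a * (ℓ′ ↾ N))        ≡⟨ cong (_+_ 1) (ℤ.*-assoc 2 (2 ^ a) (ℓ′ ↾ N)) ⟨
      1 + 2 ^ suc a * (ℓ′ ↾ N)          ∎
      where open ≡-Reasoning

    -- On level n we use k and ℓ′ modulo 2^(a+2+n): any precision ≥ n would serve z-divides, and this
    -- one makes k = 1 + 2^(a+1) ℓ′ hold exactly with ℓ′ odd.
    k⟨_⟩ : ℕ → ℤ
    k⟨ n ⟩ = k ↾ (suc a ℕ.+ suc n)

    ℓ′⟨_⟩ : ℕ → ℤ
    ℓ′⟨ n ⟩ = ℓ′ ↾ suc n

    module _ {m : ℤ₂} (m-low : ∀ i → i ℕ.≤ a → m i ≡ false) where

      m′ : ℤ₂
      m′ = shift (suc a) m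

      conjugator : Aut
      conjugator = comp (pow gamma m′) (z ℓ′)

      m-decomposition : ∀ n → m ↾ n ≡ 2 ^ suc a * (m′ ↾ n) [mod 2 ^ n ]
      m-decomposition n = mod-trans (mod-sym (↾-congruent m (ℕ.m≤n+m n (suc a))))
                                    (mod-reflexive (↾-shift (suc a) m n (λ i i≤a → m-low i (ℕ.≤-pred i≤a))))

      -- The conjugator acts as x ↦ (x − m′) / ℓ′, and both composites are x ↦ (x − k m′) / (k ℓ′).
      conjugator∘z : ∀ w → let n = length w in
        k⟨ n ⟩ * ℓ′⟨ n ⟩ * ⟦ act conjugator (act (z k) w) ⟧ ≡ ⟦ w ⟧ - k⟨ n ⟩ * (m′ ↾ n) [mod 2 ^ n ]
      conjugator∘z w = begin
        k⟨ n ⟩ * ℓ′⟨ n ⟩ * ⟦ act conjugator Z ⟧      ≡⟨ ℤ.*-assoc k⟨ n ⟩ ℓ′⟨ n ⟩ ⟦ act conjugator Z ⟧ ⟩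
        k⟨ n ⟩ * (ℓ′⟨ n ⟩ * ⟦ act conjugator Z ⟧)    ≈⟨ mod-*ˡ k⟨ n ⟩ (affine-action ℓ′₀ m′ Z (act-length (z k) w) (ℕ.n≤1+n n)) ⟩
        k⟨ n ⟩ * (⟦ Z ⟧ - m′ ↾ n)                    ≡⟨ lemma k⟨ n ⟩ ⟦ Z ⟧ (m′ ↾ n) ⟩
        k⟨ n ⟩ * ⟦ Z ⟧ - k⟨ n ⟩ * (m′ ↾ n)           ≈⟨ mod-subʳ (k⟨ n ⟩ * (m′ ↾ n)) (z-divides k₀ w refl (n≤m+[1+n] (suc a) n)) ⟩
        ⟦ w ⟧ - k⟨ n ⟩ * (m′ ↾ n)                    ∎
        where
          n : ℕ
          n = length w
          open ≡-mod-Reasoning (2 ^ n)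
          Z : Word
          Z = act (z k) w
          lemma : ∀ K x y → K * (x - y) ≡ K * x - K * y
          lemma = solve-∀

      γ^m∘z∘conjugator : ∀ w → let n = length w in
        k⟨ n ⟩ * ℓ′⟨ n ⟩ * ⟦ act (comp (pow gamma m) (z k)) (act conjugator w) ⟧ ≡ ⟦ w ⟧ - k⟨ n ⟩ * (m′ ↾ n) [mod 2 ^ n ]
      γ^m∘z∘conjugator w = begin
        k⟨ n ⟩ * ℓ′⟨ n ⟩ * ⟦ act α C ⟧                ≡⟨ lemma₁ k⟨ n ⟩ ℓ′⟨ n ⟩ ⟦ act α C ⟧ ⟩
        ℓ′⟨ n ⟩ * (k⟨ n ⟩ * ⟦ act α C ⟧)              ≈⟨ mod-*ˡ ℓ′⟨ n ⟩ (affine-action k₀ m C (act-length conjugator w) (n≤m+[1+n] (suc a) n)) ⟩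
        ℓ′⟨ n ⟩ * (⟦ C ⟧ - m ↾ n)                     ≡⟨ lemma₂ ℓ′⟨ n ⟩ ⟦ C ⟧ (m ↾ n) ⟩
        ℓ′⟨ n ⟩ * ⟦ C ⟧ - ℓ′⟨ n ⟩ * (m ↾ n)           ≈⟨ mod-subʳ (ℓ′⟨ n ⟩ * (m ↾ n)) (affine-action ℓ′₀ m′ w refl (ℕ.n≤1+n n)) ⟩
        ⟦ w ⟧ - m′ ↾ n - ℓ′⟨ n ⟩ * (m ↾ n)            ≈⟨ mod-subˡ (⟦ w ⟧ - m′ ↾ n) (mod-*ˡ ℓ′⟨ n ⟩ (m-decomposition n)) ⟩
        ⟦ w ⟧ - m′ ↾ n - ℓ′⟨ n ⟩ * (2 ^ suc a * M)    ≡⟨ lemma₃ ⟦ w ⟧ M ℓ′⟨ n ⟩ (2 ^ suc a) ⟩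
        ⟦ w ⟧ - (1 + 2 ^ suc a * ℓ′⟨ n ⟩) * M          ≡⟨ cong (λ K → ⟦ w ⟧ - K * M) (k-decomposition (suc n)) ⟨
        ⟦ w ⟧ - k⟨ n ⟩ * M                            ∎
        where
          n : ℕ
          n = length w
          open ≡-mod-Reasoning (2 ^ n)
          α : Aut
          α = comp (pow gamma m) (z k)
          C : Word
          C = act conjugator w
          M : ℤ
          M = m′ ↾ n
          lemma₁ : ∀ K L x → K * L * x ≡ L * (K * x)
          lemma₁ = solve-∀
          lemma₂ : ∀ K x y → K * (x - y) ≡ K * x - K * y
          lemma₂ = solve-∀
          lemma₃ : ∀ x y K p → x - y - K * (p * y) ≡ x - (1 + p * K) * y
          lemma₃ = solve-∀

      conjugator-intertwines : Intertwines conjugator (z k) (comp (pow gamma m) (z k))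
      conjugator-intertwines w =
        ⟦⟧-injective _ _ (trans (act-length conjugator (act (z k) w)) (act-length (z k) w))
                         (trans (act-length (comp (pow gamma m) (z k)) (act conjugator w)) (act-length conjugator w))
                         (mod-odd-cancel (length w) (odd-* (↾-odd k₀ (a ℕ.+ suc (length w))) (↾-odd ℓ′₀ (length w)))
                                         (mod-trans (conjugator∘z w) (mod-sym (γ^m∘z∘conjugator w))))

    z-fixes : ∀ d u → length u ℕ.≤ suc a → act (z k) (replicate d false ++ u) ≡ replicate d false ++ u
    z-fixes d u |u|≤a+1 = z-period⇐ k₀ 1 y refl (n≤m+[1+n] (suc a) n) (s≤s z≤n) (begin
      k⟨ n ⟩ ^ 1 * ⟦ y ⟧                                ≡⟨ cong₂ _*_ (trans (ℤ.*-identityʳ k⟨ n ⟩) (k-decomposition (suc n))) (⟦replicate-false⟧ d u) ⟩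
      (1 + 2 ^ suc a * ℓ′⟨ n ⟩) * (2 ^ d * ⟦ u ⟧)       ≈⟨ mod-2^-≤ n≤d+a+1 (unit-fixes d (suc a) ℓ′⟨ n ⟩ ⟦ u ⟧) ⟩
      2 ^ d * ⟦ u ⟧                                     ≡⟨ ⟦replicate-false⟧ d u ⟨
      ⟦ y ⟧                                             ∎)
      where
        y : Word
        y = replicate d false ++ u
        n : ℕ
        n = length y
        open ≡-mod-Reasoning (2 ^ n)
        n≤d+a+1 : n ℕ.≤ d ℕ.+ suc a
        n≤d+a+1 = ℕ.≤-trans (ℕ.≤-reflexive (length-zeros++ d u)) (ℕ.+-monoʳ-≤ d |u|≤a+1)

    module _ (1≤a : 1 ℕ.≤ a) where

      orbit-length : ∀ r t E → length t ≡ a ℕ.+ E → OrbitLen (z k) (replicate r false ++ true ∷ t) (2 ℕ.^ E)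
      orbit-length r t E |t| = ℕ.m^n>0 2 E , period , minimal E refl
        where
          y : Word
          y = replicate r false ++ true ∷ t
          n : ℕ
          n = r ℕ.+ suc (a ℕ.+ E)
          |y| : length y ≡ n
          |y| = trans (length-zeros++ r (true ∷ t)) (cong (λ l → r ℕ.+ suc l) |t|)
          K : ℤ
          K = k⟨ n ⟩
          ⟦y⟧≡ : ⟦ y ⟧ ≡ 2 ^ r * (1 + 2 * ⟦ t ⟧)
          ⟦y⟧≡ = ⟦replicate-false⟧ r (true ∷ t)

          lift : ∀ j → ∃ λ O′ → Odd O′ × K ^ (2 ℕ.^ j) ≡ 1 + 2 ^ (suc a ℕ.+ j) * O′
          lift j with lifting-the-exponent (s≤s 1≤a) (↾-odd ℓ′₀ n) j
          ... | O′ , odd-O′ , eq = O′ , odd-O′ , trans (cong (λ K → K ^ (2 ℕ.^ j)) (k-decomposition (suc n))) eq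

          K^2^-fixes : ∀ j → K ^ (2 ℕ.^ j) * ⟦ y ⟧ ≡ ⟦ y ⟧ [mod 2 ^ (r ℕ.+ (suc a ℕ.+ j)) ]
          K^2^-fixes j with lift j
          ... | O′ , _ , eq = subst₂ (λ x v → x * v ≡ v [mod 2 ^ (r ℕ.+ (suc a ℕ.+ j)) ]) (sym eq) (sym ⟦y⟧≡)
                                     (unit-fixes r (suc a ℕ.+ j) O′ (1 + 2 * ⟦ t ⟧))

          K^2^-moves : ∀ j → ¬ K ^ (2 ℕ.^ j) * ⟦ y ⟧ ≡ ⟦ y ⟧ [mod 2 ^ suc (r ℕ.+ (suc a ℕ.+ j)) ]
          K^2^-moves j with lift j
          ... | O′ , odd-O′ , eq = unit-moves r (suc a ℕ.+ j) odd-O′ (⟦ t ⟧ , refl)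
                                 ∘ subst₂ (λ x v → x * v ≡ v [mod 2 ^ suc (r ℕ.+ (suc a ℕ.+ j)) ]) eq ⟦y⟧≡

          period : iter (act (z k)) (2 ℕ.^ E) y ≡ y
          period = z-period⇐ k₀ (2 ℕ.^ E) y |y| (n≤m+[1+n] (suc a) n) (s≤s z≤n) (K^2^-fixes E)

          minimal : ∀ E′ → E′ ≡ E → ∀ s → 0 ℕ.< s → s ℕ.< 2 ℕ.^ E′ → iter (act (z k)) s y ≢ y
          minimal zero    _    s 0<s s<1 = contradiction (ℕ.n<1⇒n≡0 s<1) (ℕ.>⇒≢ 0<s)
          minimal (suc e) refl = 2^-minimal-period (act (z k)) e period
            (K^2^-moves e ∘ subst (λ j → K ^ (2 ℕ.^ e) * ⟦ y ⟧ ≡ ⟦ y ⟧ [mod 2 ^ j ]) n≡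
                          ∘ z-period⇒ k₀ (2 ℕ.^ e) y |y| (n≤m+[1+n] (suc a) n))
            where
              n≡ : n ≡ suc (r ℕ.+ (suc a ℕ.+ e))
              n≡ = trans (cong (λ j → r ℕ.+ suc j) (ℕ.+-suc a e)) (ℕ.+-suc r (suc a ℕ.+ e))

      stable-z : ∀ r t E → length t ≡ a ℕ.+ E → Stable (z k) (replicate r false ++ true ∷ t)
      stable-z r t E |t| = 2 ℕ.^ E , orbit-length r t E |t| , orbits-above
        where
          orbits-above : ∀ u → 1 ℕ.≤ length u → OrbitLen (z k) ((replicate r false ++ true ∷ t) ++ u) (2 ℕ.^ length u ℕ.* 2 ℕ.^ E)
          orbits-above u _ = subst₂ (OrbitLen (z k)) (sym (List.++-assoc (replicate r false) (true ∷ t) u))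
            (trans (ℕ.^-distribˡ-+-* 2 E (length u)) (ℕ.*-comm (2 ℕ.^ E) (2 ℕ.^ length u)))
            (orbit-length r (t ++ u) (E ℕ.+ length u)
              (trans (List.length-++ t) (trans (cong (ℕ._+ length u) |t|) (ℕ.+-assoc a E (length u)))))

    -- Above a vertex 0^d u with |u| = a sits the fixed vertex 0^d u 0, so its orbit does not double.
    unstable-z : ∀ d u → length u ≡ a → ¬ Stable (z k) (replicate d false ++ u)
    unstable-z d u |u| (k′ , (0<k′ , _) , orbits-above) with orbits-above [ false ] (s≤s z≤n)
    ... | _ , _ , minimal = minimal 1 (s≤s z≤n) (ℕ.*-monoʳ-≤ 2 0<k′) (begin
      act (z k) ((replicate d false ++ u) ++ [ false ])   ≡⟨ cong (act (z k)) (List.++-assoc (replicate d false) u [ false ]) ⟩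
      act (z k) (replicate d false ++ u ++ [ false ])     ≡⟨ z-fixes d (u ++ [ false ]) |u0|≤a+1 ⟩
      replicate d false ++ u ++ [ false ]                 ≡⟨ List.++-assoc (replicate d false) u [ false ] ⟨
      (replicate d false ++ u) ++ [ false ]               ∎)
      where
        open ≡-Reasoning
        |u0|≤a+1 : length (u ++ [ false ]) ℕ.≤ suc a
        |u0|≤a+1 = ℕ.≤-reflexive (trans (List.length-++ u) (trans (ℕ.+-comm (length u) 1) (cong suc |u|)))

open import Data.Nat using (_+_; _^_; _≤_; _<_)

-- Counting the vertices outside stable cycles

words : ℕ → List Word
words zero    = [ [] ]
words (suc n) = map (false ∷_) (words n) ++ map (true ∷_) (words n)

length-words : ∀ n → length (words n) ≡ 2 ^ n
length-words zero    = refl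
length-words (suc n) = begin
  length (map (false ∷_) (words n) ++ map (true ∷_) (words n))       ≡⟨ List.length-++ (map (false ∷_) (words n)) ⟩
  length (map (false ∷_) (words n)) + length (map (true ∷_) (words n)) ≡⟨ cong₂ _+_ (List.length-map _ (words n)) (List.length-map _ (words n)) ⟩
  length (words n) + length (words n)                                 ≡⟨ cong (λ l → l + l) (length-words n) ⟩
  2 ^ n + 2 ^ n                                                       ≡⟨ cong (2 ^ n +_) (ℕ.+-identityʳ (2 ^ n)) ⟨
  2 ^ suc n                                                           ∎
  where open ≡-Reasoning

words-unique : ∀ n → Unique (words n)
words-unique zero    = All.[] AllPairs.∷ AllPairs.[]
words-unique (suc n) = Unique.++⁺ (Unique.map⁺ List.∷-injectiveʳ (words-unique n))
                                  (Unique.map⁺ List.∷-injectiveʳ (words-unique n)) disjoint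
  where
    disjoint : ∀ {v} → ¬ (v ∈ map (false ∷_) (words n) × v ∈ map (true ∷_) (words n))
    disjoint (v∈₀ , v∈₁) with ∈-map⁻ (false ∷_) v∈₀ | ∈-map⁻ (true ∷_) v∈₁
    ... | _ , _ , refl | _ , _ , ()

words-length : ∀ n → All.All (λ u → length u ≡ n) (words n)
words-length zero    = refl All.∷ All.[]
words-length (suc n) = All.++⁺ (All.map⁺ (All.map (cong suc) (words-length n)))
                               (All.map⁺ (All.map (cong suc) (words-length n)))

words-complete : ∀ u → u ∈ words (length u)
words-complete []          = here refl
words-complete (false ∷ u) = ∈-++⁺ˡ (∈-map⁺ (false ∷_) (words-complete u))
words-complete (true ∷ u)  = ∈-++⁺ʳ (map (false ∷_) (words (length u))) (∈-map⁺ (true ∷_) (words-complete u))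

data ZeroPrefix (d : ℕ) : Word → Set where
  zeros          : ∀ u → ZeroPrefix d (replicate d false ++ u)
  zeros-then-one : ∀ {r} t → r < d → ZeroPrefix d (replicate r false ++ true ∷ t)

zeroPrefix : ∀ d w → d ≤ length w → ZeroPrefix d w
zeroPrefix zero    w           _         = zeros w
zeroPrefix (suc d) (true ∷ w)  _         = zeros-then-one w (s≤s z≤n)
zeroPrefix (suc d) (false ∷ w) (s≤s d≤w) with zeroPrefix d w d≤w
... | zeros u              = zeros u
... | zeros-then-one t r<d = zeros-then-one t (s≤s r<d)

unstable-z⇔zero-prefix : ∀ {k a} → k 0 ≡ true → HasVal (half k) a → 1 ≤ a → ∀ d v → length v ≡ a + d
                       → (v ∈ map (replicate d false ++_) (words a) → ¬ Stable (z k) v)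
                       × (¬ Stable (z k) v → v ∈ map (replicate d false ++_) (words a))
unstable-z⇔zero-prefix {k} {a} k₀ v₂ℓ≡a 1≤a d v |v| = listed⇒unstable , unstable⇒listed
  where
    listed⇒unstable : v ∈ map (replicate d false ++_) (words a) → ¬ Stable (z k) v
    listed⇒unstable v∈ with ∈-map⁻ _ v∈
    ... | u , u∈words , refl = unstable-z {k} {a} k₀ v₂ℓ≡a d u (All.lookup (words-length a) u∈words)

    unstable⇒listed : ¬ Stable (z k) v → v ∈ map (replicate d false ++_) (words a)
    unstable⇒listed unstable with zeroPrefix d v (subst (d ≤_) (sym |v|) (ℕ.m≤n+m d a))
    ... | zeros u = ∈-map⁺ _ (subst (λ n → u ∈ words n) |u|≡a (words-complete u))
      where
        |u|≡a : length u ≡ a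
        |u|≡a = ℕ.+-cancelˡ-≡ d (length u) a (trans (sym (length-zeros++ d u)) (trans |v| (ℕ.+-comm a d)))
    ... | zeros-then-one {r} t r<d with ℕ.m≤n⇒∃[o]m+o≡n r<d
    ... | E , refl = ⊥-elim (unstable (stable-z {k} {a} k₀ v₂ℓ≡a 1≤a r t E |t|≡a+E))
      where
        lemma : ∀ a r E → a + (suc r + E) ≡ r + suc (a + E)
        lemma = ℕ.solve-∀
        |t|≡a+E : length t ≡ a + E
        |t|≡a+E = ℕ.suc-injective (ℕ.+-cancelˡ-≡ r (suc (length t)) (suc (a + E))
          (trans (sym (length-zeros++ r (true ∷ t))) (trans |v| (lemma a r E))))

nonStableCount-z : ∀ {k a} → k 0 ≡ true → HasVal (half k) a → 1 ≤ a → ∀ n → a ≤ n → NonStableCount (z k) n (2 ^ a)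
nonStableCount-z {k} {a} k₀ v₂ℓ≡a 1≤a n a≤n with ℕ.m≤n⇒∃[o]m+o≡n a≤n
... | d , refl =
  map (replicate d false ++_) (words a) ,
  Unique.map⁺ (List.++-cancelˡ (replicate d false) _ _) (words-unique a) ,
  All.map⁺ (All.map (λ {u} |u|≡a → trans (length-zeros++ d u) (trans (cong (d +_) |u|≡a) (ℕ.+-comm d a))) (words-length a)) ,
  trans (List.length-map _ (words a)) (length-words a) ,
  unstable-z⇔zero-prefix {k} {a} k₀ v₂ℓ≡a 1≤a d

proposition4p11 : (m k : ℤ₂) (a : ℕ) → k 0 ≡ true → ¬ (∀ i → k i ≡ one₂ i)
    → HasVal (half k) a → 1 ≤ a → (∀ i → i ≤ a → m i ≡ false)
    → Conjugate (comp (pow gamma m) (z k)) (z k)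
      × (∀ n → a ≤ n → NonStableCount (comp (pow gamma m) (z k)) n (2 ^ a))
-- The hypothesis k ≢ 1 is implied by v₂(ℓ) = a.
proposition4p11 m k a k₀ _ v₂ℓ≡a 1≤a m-low =
  intertwines⇒conjugate c∘z≡α∘c ,
  λ n a≤n → nonStableCount-transport c∘z≡α∘c (nonStableCount-z {k} {a} k₀ v₂ℓ≡a 1≤a n a≤n)
  where
    c∘z≡α∘c : Intertwines (conjugator {k} {a} k₀ v₂ℓ≡a {m} m-low) (z k) (comp (pow gamma m) (z k))
    c∘z≡α∘c = conjugator-intertwines {k} {a} k₀ v₂ℓ≡a {m} m-low
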